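{- Let $T$ be a maximally strongly consistent $\mathcal{L}$-theory of $RGL^*$ and let $\varphi,\psi$ be $\mathcal{L}$-sentences with $T\vdash\varphi\vee\psi$. Then $T\vdash\varphi$ or $T\vdash\psi$.
   Context: Syntax. Fix a first-order language $\mathcal{L}$ with countably many predicate, function and constant symbols. Formulas of $RGL^*$ are built from atomic formulas and nullary connectives $\bar r$, one for each $r\in[0,1]\cap\mathbb{Q}$ (including $\bar0,\bar1$), using $\wedge,\to,\forall,\exists$; an $\mathcal{L}$-theory is a set of sentences. Abbreviations: $\neg\varphi:=\varphi\to\bar1$; $\varphi\vee\psi:=((\varphi\to\psi)\to\psi)\wedge((\psi\to\varphi)\to\varphi)$; $\varphi\leftrightarrow\psi:=(\varphi\to\psi)\wedge(\psi\to\varphi)$. Proof system. Axioms (all formulas $\varphi,\psi,\chi$, rationals $r,s\in[0,1]$): (G1) $(\varphi\to\psi)\to((\psi\to\chi)\to(\varphi\to\chi))$; (G2) $(\varphi\wedge\psi)\to\varphi$; (G3) $(\varphi\wedge\psi)\to(\psi\wedge\varphi)$; (G4) $\varphi\to(\varphi\wedge\varphi)$; (G5) $(\varphi\to(\psi\to\chi))\leftrightarrow((\varphi\wedge\psi)\to\chi)$; (G6) $((\varphi\to\psi)\to\chi)\to(((\psi\to\varphi)\to\chi)\to\chi)$; (G7) $\bar1\to\varphi$; (G$\forall$1) $(\forall x\,\varphi(x))\to\varphi(t)$, $t$ substitutable; (G$\forall$2) $(\forall x(\psi\to\varphi(x)))\to(\psi\to\forall x\,\varphi(x))$, $x$ not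 free in $\psi$; (G$\forall$3) $(\forall x(\psi\vee\varphi(x)))\to(\psi\vee\forall x\,\varphi(x))$, $x$ not free in $\psi$; (G$\exists$1) $\varphi(t)\to\exists x\,\varphi(x)$; (G$\exists$2) $(\exists x(\psi\to\varphi(x)))\to(\psi\to\exists x\,\varphi(x))$, $x$ not free in $\psi$; (RGL1) $(\bar r\wedge\bar s)\leftrightarrow\overline{\max\{r,s\}}$; (RGL2) $\bar r\to\bar s$ if $r\ge s$, and $(\bar r\to\bar s)\leftrightarrow\bar s$ if $r<s$; (RGL3) $\neg\neg\bar r$ for $r<1$. Rules: modus ponens and generalization. $T\vdash\varphi$ means derivable from the axioms and $T$. $T$ is strongly consistent if $T\nvdash\bar r$ for every rational $r>0$; it is maximally strongly consistent if it is strongly consistent and not properly contained in any strongly consistent $\mathcal{L}$-theory. -}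

module Defs where

open import Data.Nat using (ℕ; zero; suc; _<_)
open import Data.Maybe using (Maybe; just; nothing)
import Data.Maybe as Maybe
open import Data.Vec using (Vec; []; _∷_)
open import Data.Product using (_×_; Σ; _,_)
open import Data.Sum using (_⊎_)
open import Data.Unit using (⊤)
open import Data.Empty using (⊥)
open import Function.Definitions using (Injective)
open import Relation.Binary.PropositionalEquality using (_≡_)
open import Relation.Nullary using (¬_)
open import Data.Rational using (ℚ; 0ℚ; 1ℚ)
  renaming (_≤_ to _≤ℚ_; _<_ to _<ℚ_; _⊔_ to _⊔ℚ_)

record Language : Set₁ where
  field
    PredSym      : Set
    FunSym       : Set
    ConstSym     : Set
    predArity    : PredSym → ℕ
    funArity     : FunSym → ℕ
    predCode     : PredSym → ℕ
    funCode      : FunSym → ℕ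
    constCode    : ConstSym → ℕ
    predCountable  : Injective _≡_ _≡_ predCode
    funCountable   : Injective _≡_ _≡_ funCode
    constCountable : Injective _≡_ _≡_ constCode

module _ (L : Language) where
  open Language L

  -- Terms, variables as de Bruijn indices.
  data Term : Set where
    var : ℕ → Term
    con : ConstSym → Term
    fun : (f : FunSym) → Vec Term (funArity f) → Term

  -- Formulas of RGL*: atoms, rational constants r̄ (r ∈ [0,1] ∩ ℚ),
  -- ∧, →, ∀, ∃ (the binders bind de Bruijn index 0).
  infixr 6 _∧_
  infixr 4 _⇒_

  data Formula : Set where
    atom : (P : PredSym) → Vec Term (predArity P) → Formula
    cst  : (r : ℚ) → .(0ℚ ≤ℚ r) → .(r ≤ℚ 1ℚ) → Formula
    _∧_  : Formula → Formula → Formula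
    _⇒_  : Formula → Formula → Formula
    all  : Formula → Formula
    ex   : Formula → Formula

module Syntax {L : Language} where
  open Language L

  0̄ : Formula L
  0̄ = cst 0ℚ (Data.Rational.Properties.≤-refl) (Data.Rational.Properties.nonNegative⁻¹ 1ℚ)
    where import Data.Rational.Properties
  1̄ : Formula L
  1̄ = cst 1ℚ (Data.Rational.Properties.nonNegative⁻¹ 1ℚ) (Data.Rational.Properties.≤-refl)
    where import Data.Rational.Properties

  infixr 5 _∨_
  infix 3 _⇔_
  infix 7 ∼_

  ∼_ : Formula L → Formula L
  ∼ φ = φ ⇒ 1̄

  _∨_ : Formula L → Formula L → Formula L
  φ ∨ ψ = ((φ ⇒ ψ) ⇒ ψ) ∧ ((ψ ⇒ φ) ⇒ φ)

  _⇔_ : Formula L → Formula L → Formula L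
  φ ⇔ ψ = (φ ⇒ ψ) ∧ (ψ ⇒ φ)

  shiftVar : ℕ → ℕ → ℕ
  shiftVar zero i = suc i
  shiftVar (suc c) zero = zero
  shiftVar (suc c) (suc i) = suc (shiftVar c i)

  mutual
    shiftT : ℕ → Term L → Term L
    shiftT c (var i) = var (shiftVar c i)
    shiftT c (con k) = con k
    shiftT c (fun f ts) = fun f (shiftTs c ts)

    shiftTs : ∀ {n} → ℕ → Vec (Term L) n → Vec (Term L) n
    shiftTs c [] = []
    shiftTs c (t ∷ ts) = shiftT c t ∷ shiftTs c ts

  shiftF : ℕ → Formula L → Formula L
  shiftF c (atom P ts) = atom P (shiftTs c ts)
  shiftF c (cst r p q) = cst r p q
  shiftF c (φ ∧ ψ) = shiftF c φ ∧ shiftF c ψ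
  shiftF c (φ ⇒ ψ) = shiftF c φ ⇒ shiftF c ψ
  shiftF c (all φ) = all (shiftF (suc c) φ)
  shiftF c (ex φ) = ex (shiftF (suc c) φ)

  -- substituting a term for variable c (variables above c move down by one);
  -- nothing means "this is the substituted variable".
  substVar : ℕ → ℕ → Maybe ℕ
  substVar zero zero = nothing
  substVar zero (suc i) = just i
  substVar (suc c) zero = just zero
  substVar (suc c) (suc i) = Maybe.map suc (substVar c i)

  mutual
    substT : ℕ → Term L → Term L → Term L
    substT c u (var i) with substVar c i
    ... | nothing = u
    ... | just j  = var j
    substT c u (con k) = con k
    substT c u (fun f ts) = fun f (substTs c u ts)

    substTs : ∀ {n} → ℕ → Term L → Vec (Term L) n → Vec (Term L) n
    substTs c u [] = []
    substTs c u (t ∷ ts) = substT c u t ∷ substTs c u ts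

  substF : ℕ → Term L → Formula L → Formula L
  substF c u (atom P ts) = atom P (substTs c u ts)
  substF c u (cst r p q) = cst r p q
  substF c u (φ ∧ ψ) = substF c u φ ∧ substF c u ψ
  substF c u (φ ⇒ ψ) = substF c u φ ⇒ substF c u ψ
  substF c u (all φ) = all (substF (suc c) (shiftT 0 u) φ)
  substF c u (ex φ) = ex (substF (suc c) (shiftT 0 u) φ)

  _[_] : Formula L → Term L → Formula L
  φ [ t ] = substF 0 t φ

  mutual
    TermBelow : ℕ → Term L → Set
    TermBelow n (var i) = i < n
    TermBelow n (con k) = ⊤
    TermBelow n (fun f ts) = TermsBelow n ts

    TermsBelow : ∀ {m} → ℕ → Vec (Term L) m → Set
    TermsBelow n [] = ⊤
    TermsBelow n (t ∷ ts) = TermBelow n t × TermsBelow n ts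

  FormulaBelow : ℕ → Formula L → Set
  FormulaBelow n (atom P ts) = TermsBelow n ts
  FormulaBelow n (cst r p q) = ⊤
  FormulaBelow n (φ ∧ ψ) = FormulaBelow n φ × FormulaBelow n ψ
  FormulaBelow n (φ ⇒ ψ) = FormulaBelow n φ × FormulaBelow n ψ
  FormulaBelow n (all φ) = FormulaBelow (suc n) φ
  FormulaBelow n (ex φ) = FormulaBelow (suc n) φ

  IsSentence : Formula L → Set
  IsSentence = FormulaBelow 0

FSet : Language → Set₁
FSet L = Formula L → Set

record Theory (L : Language) : Set₁ where
  field
    member    : FSet L
    sentences : ∀ φ → member φ → Syntax.IsSentence φ

open Theory public

module Proofs {L : Language} where
  open Syntax {L}

  infix 2 _⊢_

  data _⊢_ (T : Theory L) : Formula L → Set where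
    hyp : ∀ {φ} → member T φ → T ⊢ φ
    G1 : ∀ φ ψ χ → T ⊢ (φ ⇒ ψ) ⇒ ((ψ ⇒ χ) ⇒ (φ ⇒ χ))
    G2 : ∀ φ ψ → T ⊢ (φ ∧ ψ) ⇒ φ
    G3 : ∀ φ ψ → T ⊢ (φ ∧ ψ) ⇒ (ψ ∧ φ)
    G4 : ∀ φ → T ⊢ φ ⇒ (φ ∧ φ)
    G5 : ∀ φ ψ χ → T ⊢ (φ ⇒ (ψ ⇒ χ)) ⇔ ((φ ∧ ψ) ⇒ χ)
    G6 : ∀ φ ψ χ → T ⊢ ((φ ⇒ ψ) ⇒ χ) ⇒ (((ψ ⇒ φ) ⇒ χ) ⇒ χ)
    G7 : ∀ φ → T ⊢ 1̄ ⇒ φ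
    -- (∀x φ(x)) → φ(t); de Bruijn substitution is always capture-free
    G∀1 : ∀ φ t → T ⊢ all φ ⇒ (φ [ t ])
    -- x not free in ψ: ψ is weakened (shifted) under the binder
    G∀2 : ∀ ψ φ → T ⊢ all (shiftF 0 ψ ⇒ φ) ⇒ (ψ ⇒ all φ)
    G∀3 : ∀ ψ φ → T ⊢ all (shiftF 0 ψ ∨ φ) ⇒ (ψ ∨ all φ)
    G∃1 : ∀ φ t → T ⊢ (φ [ t ]) ⇒ ex φ
    G∃2 : ∀ ψ φ → T ⊢ ex (shiftF 0 ψ ⇒ φ) ⇒ (ψ ⇒ ex φ)
    RGL1 : ∀ r s .(r0 : 0ℚ ≤ℚ r) .(r1 : r ≤ℚ 1ℚ) .(s0 : 0ℚ ≤ℚ s) .(s1 : s ≤ℚ 1ℚ)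
             .(m0 : 0ℚ ≤ℚ (r ⊔ℚ s)) .(m1 : (r ⊔ℚ s) ≤ℚ 1ℚ) →
           T ⊢ (cst r r0 r1 ∧ cst s s0 s1) ⇔ cst (r ⊔ℚ s) m0 m1
    RGL2a : ∀ r s .(r0 : 0ℚ ≤ℚ r) .(r1 : r ≤ℚ 1ℚ) .(s0 : 0ℚ ≤ℚ s) .(s1 : s ≤ℚ 1ℚ) →
            s ≤ℚ r → T ⊢ cst r r0 r1 ⇒ cst s s0 s1
    RGL2b : ∀ r s .(r0 : 0ℚ ≤ℚ r) .(r1 : r ≤ℚ 1ℚ) .(s0 : 0ℚ ≤ℚ s) .(s1 : s ≤ℚ 1ℚ) →
            r <ℚ s → T ⊢ (cst r r0 r1 ⇒ cst s s0 s1) ⇔ cst s s0 s1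
    RGL3 : ∀ r .(r0 : 0ℚ ≤ℚ r) .(r1 : r ≤ℚ 1ℚ) → r <ℚ 1ℚ → T ⊢ ∼ (∼ cst r r0 r1)
    MP  : ∀ {φ ψ} → T ⊢ φ → T ⊢ φ ⇒ ψ → T ⊢ ψ
    Gen : ∀ {φ} → T ⊢ φ → T ⊢ all φ

  -- T ⊬ r̄ for every rational r > 0 (with r ≤ 1, so that r̄ is a formula)
  StronglyConsistent : Theory L → Set
  StronglyConsistent T =
    ∀ r .(r0 : 0ℚ ≤ℚ r) .(r1 : r ≤ℚ 1ℚ) → 0ℚ <ℚ r → ¬ (T ⊢ cst r r0 r1)

  _⊆_ : Theory L → Theory L → Set
  T ⊆ T′ = ∀ φ → member T φ → member T′ φ

  ProperlyContained : Theory L → Theory L → Set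
  ProperlyContained T T′ = T ⊆ T′ × Σ (Formula L) (λ φ → member T′ φ × ¬ member T φ)

  MaximallyStronglyConsistent : Theory L → Set₁
  MaximallyStronglyConsistent T =
    StronglyConsistent T ×
    (∀ (T′ : Theory L) → StronglyConsistent T′ → ¬ ProperlyContained T T′)

-- The metatheory of the paper is classical.
ExcludedMiddle : Set₁
ExcludedMiddle = ∀ (P : Set) → P ⊎ ¬ P

-- If T ⊬ φ, then T ∪ {φ} properly extends the maximal T, so it proves some r̄ with r > 0,
-- and the deduction theorem gives T ⊢ φ → r̄. If neither disjunct were provable we would
-- get T ⊢ φ → t̄ and T ⊢ ψ → t̄ for the smaller of the two constants t, and prelinearity
-- (G6) together with T ⊢ φ ∨ ψ yields T ⊢ t̄, contradicting strong consistency.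
module Submission where

open import Defs
open import Data.Sum using (_⊎_; inj₁; inj₂)
open import Data.Nat using (zero; suc; s≤s; _<_)
open import Data.Vec using (Vec; []; _∷_)
open import Data.Product using (_,_; ∃-syntax; proj₁)
open import Data.Empty using (⊥-elim)
open import Relation.Binary.PropositionalEquality using (_≡_; refl; cong; cong₂; subst)
open import Relation.Nullary using (¬_)
open import Data.Rational using (ℚ; 0ℚ; 1ℚ) renaming (_≤_ to _≤ℚ_; _<_ to _<ℚ_)
open import Data.Rational.Properties using (<⇒≤; ≤-total)

record PositiveRational : Set where
  field
    value     : ℚ
    positive  : 0ℚ <ℚ value
    .atMostOne : value ≤ℚ 1ℚ

open PositiveRational

module _ {L : Language} where
  open Syntax {L}
  open Proofs {L}

  constant : PositiveRational → Formula L
  constant record { value = r ; positive = r>0 ; atMostOne = r≤1 } = cst r (<⇒≤ r>0) r≤1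

  shiftVar-id : ∀ c i → i < c → shiftVar c i ≡ i
  shiftVar-id (suc c) zero    _       = refl
  shiftVar-id (suc c) (suc i) (s≤s p) = cong suc (shiftVar-id c i p)

  mutual
    shiftT-id : ∀ c t → TermBelow c t → shiftT c t ≡ t
    shiftT-id c (var i)    p = cong var (shiftVar-id c i p)
    shiftT-id c (con k)    p = refl
    shiftT-id c (fun f ts) p = cong (fun f) (shiftTs-id c ts p)

    shiftTs-id : ∀ {n} c (ts : Vec (Term L) n) → TermsBelow c ts → shiftTs c ts ≡ ts
    shiftTs-id c []       _       = refl
    shiftTs-id c (t ∷ ts) (p , q) = cong₂ _∷_ (shiftT-id c t p) (shiftTs-id c ts q)

  shiftF-id : ∀ c φ → FormulaBelow c φ → shiftF c φ ≡ φ
  shiftF-id c (atom P ts) p       = cong (atom P) (shiftTs-id c ts p)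
  shiftF-id c (cst r _ _) _       = refl
  shiftF-id c (φ ∧ ψ)     (p , q) = cong₂ _∧_ (shiftF-id c φ p) (shiftF-id c ψ q)
  shiftF-id c (φ ⇒ ψ)     (p , q) = cong₂ _⇒_ (shiftF-id c φ p) (shiftF-id c ψ q)
  shiftF-id c (all φ)     p       = cong all (shiftF-id (suc c) φ p)
  shiftF-id c (ex φ)      p       = cong ex (shiftF-id (suc c) φ p)

  module _ {T : Theory L} where

    ⇒-trans : ∀ {a b c} → T ⊢ a ⇒ b → T ⊢ b ⇒ c → T ⊢ a ⇒ c
    ⇒-trans {a} {b} {c} ab bc = MP bc (MP ab (G1 a b c))

    ∧-proj₁ : ∀ {a b} → T ⊢ a ∧ b → T ⊢ a
    ∧-proj₁ {a} {b} d = MP d (G2 a b)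

    ∧-proj₂ : ∀ {a b} → T ⊢ a ∧ b → T ⊢ b
    ∧-proj₂ {a} {b} d = MP (MP d (G3 a b)) (G2 b a)

    ⇒-refl : ∀ a → T ⊢ a ⇒ a
    ⇒-refl a = ⇒-trans (G4 a) (G2 a a)

    curry : ∀ {a b c} → T ⊢ (a ∧ b) ⇒ c → T ⊢ a ⇒ (b ⇒ c)
    curry {a} {b} {c} d = MP d (∧-proj₂ (G5 a b c))

    uncurry : ∀ {a b c} → T ⊢ a ⇒ (b ⇒ c) → T ⊢ (a ∧ b) ⇒ c
    uncurry {a} {b} {c} d = MP d (∧-proj₁ (G5 a b c))

    ⇒-weaken : ∀ {a} b → T ⊢ a → T ⊢ b ⇒ a
    ⇒-weaken {a} b d = MP d (curry (G2 a b))

    ⇒-MP : ∀ {p a b} → T ⊢ p ⇒ a → T ⊢ p ⇒ (a ⇒ b) → T ⊢ p ⇒ b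
    ⇒-MP {p} {a} {b} pa pab =
      ⇒-trans (G4 p) (uncurry (⇒-trans pa (curry (⇒-trans (G3 a p) (uncurry pab)))))

    ∨-elim : ∀ {φ ψ χ} → T ⊢ φ ∨ ψ → T ⊢ φ ⇒ χ → T ⊢ ψ ⇒ χ → T ⊢ χ
    ∨-elim {φ} {ψ} {χ} d φχ ψχ =
      MP (⇒-trans (∧-proj₂ d) φχ) (MP (⇒-trans (∧-proj₁ d) ψχ) (G6 φ ψ χ))

    constant-antitone : ∀ q q′ → value q′ ≤ℚ value q → T ⊢ constant q ⇒ constant q′
    constant-antitone q q′ q′≤q = RGL2a (value q) (value q′) _ _ _ _ q′≤q

  extend : (T : Theory L) (φ : Formula L) → IsSentence φ → Theory L
  member (extend T φ s) χ = member T χ ⊎ χ ≡ φ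
  sentences (extend T φ s) χ (inj₁ m)    = sentences T χ m
  sentences (extend T φ s) χ (inj₂ refl) = s

  deduction : ∀ {T φ} (s : IsSentence φ) {χ} → extend T φ s ⊢ χ → T ⊢ φ ⇒ χ
  deduction {φ = φ} s (hyp (inj₁ m))    = ⇒-weaken φ (hyp m)
  deduction {φ = φ} s (hyp (inj₂ refl)) = ⇒-refl φ
  deduction {φ = φ} s (G1 a b c)        = ⇒-weaken φ (G1 a b c)
  deduction {φ = φ} s (G2 a b)          = ⇒-weaken φ (G2 a b)
  deduction {φ = φ} s (G3 a b)          = ⇒-weaken φ (G3 a b)
  deduction {φ = φ} s (G4 a)            = ⇒-weaken φ (G4 a)
  deduction {φ = φ} s (G5 a b c)        = ⇒-weaken φ (G5 a b c)
  deduction {φ = φ} s (G6 a b c)        = ⇒-weaken φ (G6 a b c)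
  deduction {φ = φ} s (G7 a)            = ⇒-weaken φ (G7 a)
  deduction {φ = φ} s (G∀1 a t)         = ⇒-weaken φ (G∀1 a t)
  deduction {φ = φ} s (G∀2 a b)         = ⇒-weaken φ (G∀2 a b)
  deduction {φ = φ} s (G∀3 a b)         = ⇒-weaken φ (G∀3 a b)
  deduction {φ = φ} s (G∃1 a t)         = ⇒-weaken φ (G∃1 a t)
  deduction {φ = φ} s (G∃2 a b)         = ⇒-weaken φ (G∃2 a b)
  deduction {φ = φ} s (RGL1 r t r0 r1 t0 t1 m0 m1) = ⇒-weaken φ (RGL1 r t r0 r1 t0 t1 m0 m1)
  deduction {φ = φ} s (RGL2a r t r0 r1 t0 t1 t≤r)  = ⇒-weaken φ (RGL2a r t r0 r1 t0 t1 t≤r)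
  deduction {φ = φ} s (RGL2b r t r0 r1 t0 t1 r<t)  = ⇒-weaken φ (RGL2b r t r0 r1 t0 t1 r<t)
  deduction {φ = φ} s (RGL3 r r0 r1 r<1)           = ⇒-weaken φ (RGL3 r r0 r1 r<1)
  deduction s (MP d e) = ⇒-MP (deduction s d) (deduction s e)
  -- Generalization is sound under the hypothesis only because φ is closed: G∀2 applies
  -- once its shifted copy of φ is identified with φ.
  deduction {T} {φ} s (Gen {χ} d) =
    MP (Gen (deduction s d))
       (subst (λ φ′ → T ⊢ all (φ′ ⇒ χ) ⇒ (φ ⇒ all χ)) (shiftF-id 0 φ s) (G∀2 φ χ))

  unprovable⇒implies-constant : ExcludedMiddle → ∀ {T} → MaximallyStronglyConsistent T →
    ∀ {φ} (s : IsSentence φ) → ¬ (T ⊢ φ) → ∃[ q ] (T ⊢ φ ⇒ constant q)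
  unprovable⇒implies-constant em {T} (_ , maximal) {φ} s ⊬φ
    with em (∃[ q ] (extend T φ s ⊢ constant q))
  ... | inj₁ (q , ⊢q) = q , deduction s ⊢q
  ... | inj₂ ⊬const   =
    ⊥-elim (maximal (extend T φ s) stronglyConsistent
                    ((λ _ → inj₁) , φ , inj₂ refl , λ m → ⊬φ (hyp m)))
    where
    stronglyConsistent : StronglyConsistent (extend T φ s)
    stronglyConsistent r _ r≤1 r>0 ⊢r =
      ⊬const (record { value = r ; positive = r>0 ; atMostOne = r≤1 } , ⊢r)

  ∨-elim-constants : ∀ {T φ ψ} q q′ → T ⊢ φ ∨ ψ →
    T ⊢ φ ⇒ constant q → T ⊢ ψ ⇒ constant q′ → T ⊢ constant q ⊎ T ⊢ constant q′
  ∨-elim-constants q q′ d φq ψq′ with ≤-total (value q) (value q′)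
  ... | inj₁ q≤q′ = inj₁ (∨-elim d φq (⇒-trans ψq′ (constant-antitone q′ q q≤q′)))
  ... | inj₂ q′≤q = inj₂ (∨-elim d (⇒-trans φq (constant-antitone q q′ q′≤q)) ψq′)

  stronglyConsistent⇒⊬constant : ∀ {T} → StronglyConsistent T → ∀ q → ¬ (T ⊢ constant q)
  stronglyConsistent⇒⊬constant sc record { value = r ; positive = r>0 ; atMostOne = r≤1 } =
    sc r (<⇒≤ r>0) r≤1 r>0

mainTheorem8 : ExcludedMiddle → (L : Language) → (T : Theory L) →
    Proofs.MaximallyStronglyConsistent T →
    (φ ψ : Formula L) → Syntax.IsSentence φ → Syntax.IsSentence ψ →
    Proofs._⊢_ T (Syntax._∨_ φ ψ) →
    Proofs._⊢_ T φ ⊎ Proofs._⊢_ T ψ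
mainTheorem8 em L T msc φ ψ sφ sψ d with em (Proofs._⊢_ T φ) | em (Proofs._⊢_ T ψ)
... | inj₁ ⊢φ | _       = inj₁ ⊢φ
... | inj₂ _  | inj₁ ⊢ψ = inj₂ ⊢ψ
... | inj₂ ⊬φ | inj₂ ⊬ψ
  with unprovable⇒implies-constant em msc sφ ⊬φ | unprovable⇒implies-constant em msc sψ ⊬ψ
... | q , φq | q′ , ψq′ with ∨-elim-constants q q′ d φq ψq′
...   | inj₁ ⊢q  = ⊥-elim (stronglyConsistent⇒⊬constant (proj₁ msc) q ⊢q)
...   | inj₂ ⊢q′ = ⊥-elim (stronglyConsistent⇒⊬constant (proj₁ msc) q′ ⊢q′)
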